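{- Let $S$ be a finite ground-set and let $(p^*_1,b^*_1)$, $(p^*_2,b^*_2)$ be strong pairs on $S$ such that $p^*_1(S)=b^*_1(S)=p^*_2(S)=b^*_2(S)=:H$ (finite), so that $Q_i:=Q(p^*_i,b^*_i)$ equals the base-polyhedron $B(b^*_i)$ for $i=1,2$. Let $f\le g$ be functions on $S$ ($f$ may take $-\infty$, $g$ may take $+\infty$) and $T:=\{x:f\le x\le g\}$. Then the requirement that $p^*_1(X_1)+\tilde f(X_2-X_1)\le b^*_2(X_2)+\tilde g(X_1-X_2)$ hold for all $X_1,X_2\subseteq S$ is equivalent to the requirement that $p^*_2(X_2)+\tilde f(X_1-X_2)\le b^*_1(X_1)+\tilde g(X_2-X_1)$ hold for all $X_1,X_2\subseteq S$; and $Q_1\cap Q_2\cap T$ is non-empty if and only if $$H\le b^*_1(X')+b^*_2(X'')+\tilde g(\overline{X'}\cap\overline{X''})-\tilde f(X'\cap X'')$$ holds for every $X',X''\subseteq S$.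
   Context: Set-functions on $S$ are integer-valued, vanish on $\emptyset$; lower-type ($p$) may take $-\infty$, upper-type ($b$) may take $+\infty$. For a function $h$ on $S$ and $Z\subseteq S$, $\tilde h(Z)=\sum_{s\in Z}h(s)$; $\overline Z=S-Z$. $b$ is fully submodular if $b(X)+b(Y)\ge b(X\cap Y)+b(X\cup Y)$ for all $X,Y$; $p$ is fully supermodular if $-p$ is fully submodular. A strong pair $(p,b)$: $p$ fully supermodular, $b$ fully submodular, and $b(X)-p(Y)\ge b(X-Y)-p(Y-X)$ for all $X,Y\subseteq S$. $Q(p,b):=\{x:p(Z)\le\tilde x(Z)\le b(Z)\ \forall Z\subseteq S\}$. $B(b):=\{x:\tilde x(Z)\le b(Z)\ \forall Z\subsetneq S,\ \tilde x(S)=b(S)\}$. -}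

module Defs where

open import Data.Nat using (ℕ; zero; suc)
open import Data.Integer as ℤ using (ℤ)
open import Data.Fin using (Fin) renaming (zero to fzero; suc to fsuc)
open import Data.Fin.Subset using (Subset; inside; outside; _∩_; _∪_; _─_; ∁; ⊥; ⊤)
open import Data.Vec using ([]; _∷_)
open import Data.Empty renaming (⊥ to Empty)
open import Data.Unit using () renaming (⊤ to Unit)
open import Data.Product using (_×_; Σ)

-- Extended integers.
-- ℤ₋ = ℤ ∪ {-∞}  (values of lower-type functions p, f)
-- ℤ₊ = ℤ ∪ {+∞}  (values of upper-type functions b, g)

data ℤ₋ : Set where
  -∞   : ℤ₋
  fin₋ : ℤ → ℤ₋

data ℤ₊ : Set where
  fin₊ : ℤ → ℤ₊
  +∞   : ℤ₊

infixl 6 _+₋_ _+₊_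

_+₋_ : ℤ₋ → ℤ₋ → ℤ₋
-∞     +₋ _      = -∞
fin₋ a +₋ -∞     = -∞
fin₋ a +₋ fin₋ b = fin₋ (a ℤ.+ b)

_+₊_ : ℤ₊ → ℤ₊ → ℤ₊
+∞     +₊ _      = +∞
fin₊ a +₊ +∞     = +∞
fin₊ a +₊ fin₊ b = fin₊ (a ℤ.+ b)

neg : ℤ₋ → ℤ₊
neg -∞       = +∞
neg (fin₋ a) = fin₊ (ℤ.- a)

infix 4 _≤₋_ _≤₊_ _≤⁎_

_≤₋_ : ℤ₋ → ℤ₋ → Set
-∞     ≤₋ _      = Unit
fin₋ a ≤₋ -∞     = Empty
fin₋ a ≤₋ fin₋ b = a ℤ.≤ b

_≤₊_ : ℤ₊ → ℤ₊ → Set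
_      ≤₊ +∞     = Unit
+∞     ≤₊ fin₊ b = Empty
fin₊ a ≤₊ fin₊ b = a ℤ.≤ b

_≤⁎_ : ℤ₋ → ℤ₊ → Set
-∞     ≤⁎ _      = Unit
fin₋ a ≤⁎ +∞     = Unit
fin₋ a ≤⁎ fin₊ b = a ℤ.≤ b

-- Modular extension  h̃(Z) = Σ_{s ∈ Z} h(s), ground set S = Fin n.

module _ {A : Set} (0# : A) (_⊕_ : A → A → A) where
  sumOver : ∀ {n} → (Fin n → A) → Subset n → A
  sumOver {zero}  h []             = 0#
  sumOver {suc n} h (inside  ∷ Z)  = h fzero ⊕ sumOver (λ s → h (fsuc s)) Z
  sumOver {suc n} h (outside ∷ Z)  = sumOver (λ s → h (fsuc s)) Z

tildeℤ : ∀ {n} → (Fin n → ℤ) → Subset n → ℤ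
tildeℤ = sumOver (ℤ.+ 0) ℤ._+_

tilde₋ : ∀ {n} → (Fin n → ℤ₋) → Subset n → ℤ₋
tilde₋ = sumOver (fin₋ (ℤ.+ 0)) _+₋_

tilde₊ : ∀ {n} → (Fin n → ℤ₊) → Subset n → ℤ₊
tilde₊ = sumOver (fin₊ (ℤ.+ 0)) _+₊_

LowerSetFn : ℕ → Set
LowerSetFn n = Subset n → ℤ₋

UpperSetFn : ℕ → Set
UpperSetFn n = Subset n → ℤ₊

FullySupermodular : ∀ {n} → LowerSetFn n → Set
FullySupermodular p = ∀ X Y → p X +₋ p Y ≤₋ p (X ∩ Y) +₋ p (X ∪ Y)

FullySubmodular : ∀ {n} → UpperSetFn n → Set
FullySubmodular b = ∀ X Y → b (X ∩ Y) +₊ b (X ∪ Y) ≤₊ b X +₊ b Y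

StrongPair : ∀ {n} → LowerSetFn n → UpperSetFn n → Set
StrongPair p b =
  (p ⊥ ≡₋ fin₋ (ℤ.+ 0)) × (b ⊥ ≡₊ fin₊ (ℤ.+ 0)) ×
  FullySupermodular p × FullySubmodular b ×
  (∀ X Y → b (X ─ Y) +₊ neg (p (Y ─ X)) ≤₊ b X +₊ neg (p Y))
  where
  open import Relation.Binary.PropositionalEquality using (_≡_)
  _≡₋_ : ℤ₋ → ℤ₋ → Set
  _≡₋_ = _≡_
  _≡₊_ : ℤ₊ → ℤ₊ → Set
  _≡₊_ = _≡_

Q : ∀ {n} → LowerSetFn n → UpperSetFn n → (Fin n → ℤ) → Set
Q p b x = ∀ Z → (p Z ≤⁎ fin₊ (tildeℤ x Z)) × (fin₋ (tildeℤ x Z) ≤⁎ b Z)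

T : ∀ {n} → (Fin n → ℤ₋) → (Fin n → ℤ₊) → (Fin n → ℤ) → Set
T f g x = ∀ s → (f s ≤⁎ fin₊ (x s)) × (fin₋ (x s) ≤⁎ g s)

-- For a strong pair (p, b) with p(S) = b(S) = H one has b(∁Z) = H − p(Z), so Q(p, b) is the base
-- polyhedron of b, and each of the two conditions says, after substituting X ↦ ∁X, that the surplus
-- b₁(X) + b₂(Y) + g̃(∁X ∩ ∁Y) − f̃(X ∩ Y) − H is nonnegative for all X, Y.  Nonnegativity is necessary
-- by a direct estimate.  It is sufficient by induction on |S|: every lower bound on the first
-- coordinate x₀ (from f₀, or from the surplus of a pair of sets avoiding 0) is compatible with every
-- upper bound (from g₀, or from the surplus of a pair of sets containing 0); for two surplus bounds
-- this follows by uncrossing the two pairs with submodularity.  Fixing x₀ at a compatible value α leaves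
-- the same problem on the remaining coordinates, for the submodular functions
-- Z ↦ min (bᵢ(Z), bᵢ(Z + 0) − α), and its surplus is again nonnegative.
module Submission where

open import Defs
open import Level using (0ℓ)
open import Function using (_∘_)
open import Function.Bundles using (_⇔_; mk⇔; Equivalence)
open import Function.Properties.Equivalence using () renaming (trans to ⇔-trans; sym to ⇔-sym)
open import Data.Unit using (tt)
open import Data.Product using (_×_; _,_; Σ; proj₁; proj₂)
open import Data.Sum using (_⊎_; inj₁; inj₂; [_,_]′)
open import Data.Bool using (Bool; true; false; not; _∧_; _∨_)
open import Data.Bool.Properties using (not-involutive)
open import Data.Nat using (ℕ; zero; suc)
open import Data.Integer as ℤ using (ℤ; +_)
import Data.Integer.Properties as ℤP
open import Data.Integer.Tactic.RingSolver using (solve-∀)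
open import Data.Fin using (Fin) renaming (zero to fzero; suc to fsuc)
open import Data.Fin.Subset using (Subset; inside; outside; _∩_; _∪_; _─_; ∁; ⊥; ⊤)
open import Data.Fin.Subset.Properties
  using (p─⊤≡⊥; ∩-comm; ∩-zeroˡ; ∩-zeroʳ; ∩-identityˡ; ∩-identityʳ; ∩-inverseˡ)
open import Data.Vec using ([]; _∷_)
open import Data.Vec.Properties using (map-∘; map-cong; map-id)
open import Data.Vec.Functional using (tail)
import Data.Vec.Functional as Vector
open import Algebra.Bundles using (CommutativeMonoid)
import Algebra.Properties.CommutativeSemigroup as CommutativeSemigroupProperties
open import Relation.Binary.Bundles using (Preorder)
import Relation.Binary.Reasoning.Preorder as PreorderReasoning
open import Relation.Binary.PropositionalEquality

-- Arithmetic in ℤ ∪ {+∞}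

0₊ : ℤ₊
0₊ = fin₊ (+ 0)

+₊-comm : ∀ u v → u +₊ v ≡ v +₊ u
+₊-comm (fin₊ a) (fin₊ b) = cong fin₊ (ℤP.+-comm a b)
+₊-comm (fin₊ a) +∞       = refl
+₊-comm +∞       (fin₊ b) = refl
+₊-comm +∞       +∞       = refl

+₊-assoc : ∀ u v w → (u +₊ v) +₊ w ≡ u +₊ (v +₊ w)
+₊-assoc (fin₊ a) (fin₊ b) (fin₊ c) = cong fin₊ (ℤP.+-assoc a b c)
+₊-assoc (fin₊ a) (fin₊ b) +∞       = refl
+₊-assoc (fin₊ a) +∞       _        = refl
+₊-assoc +∞       _        _        = refl

+₊-identityˡ : ∀ u → 0₊ +₊ u ≡ u
+₊-identityˡ (fin₊ a) = cong fin₊ (ℤP.+-identityˡ a)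
+₊-identityˡ +∞       = refl

+₊-identityʳ : ∀ u → u +₊ 0₊ ≡ u
+₊-identityʳ u = trans (+₊-comm u 0₊) (+₊-identityˡ u)

+₊-commutativeMonoid : CommutativeMonoid 0ℓ 0ℓ
+₊-commutativeMonoid = record
  { Carrier = ℤ₊ ; _≈_ = _≡_ ; _∙_ = _+₊_ ; ε = 0₊
  ; isCommutativeMonoid = record
    { isMonoid = record
      { isSemigroup = record
        { isMagma = record { isEquivalence = isEquivalence ; ∙-cong = cong₂ _+₊_ }
        ; assoc   = +₊-assoc }
      ; identity = +₊-identityˡ , +₊-identityʳ }
    ; comm = +₊-comm } }

open CommutativeSemigroupProperties (CommutativeMonoid.commutativeSemigroup +₊-commutativeMonoid)
  using (interchange)
open import Algebra.Solver.CommutativeMonoid +₊-commutativeMonoid using (solve; _⊜_; _⊕_)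

fin₊-injective : ∀ {a b} → fin₊ a ≡ fin₊ b → a ≡ b
fin₊-injective refl = refl

fin₊-inverseʳ : ∀ a → fin₊ a +₊ fin₊ (ℤ.- a) ≡ 0₊
fin₊-inverseʳ a = cong fin₊ (ℤP.+-inverseʳ a)

+₊-cancel-fin : ∀ u a → u +₊ fin₊ a +₊ fin₊ (ℤ.- a) ≡ u
+₊-cancel-fin u a = trans (+₊-assoc u (fin₊ a) _) (trans (cong (u +₊_) (fin₊-inverseʳ a)) (+₊-identityʳ u))

neg-+ : ∀ a b → neg (a +₋ b) ≡ neg a +₊ neg b
neg-+ -∞       _        = refl
neg-+ (fin₋ x) -∞       = refl
neg-+ (fin₋ x) (fin₋ y) = cong fin₊ (ℤP.neg-distrib-+ x y)

≤₊-refl : ∀ {u} → u ≤₊ u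
≤₊-refl {fin₊ a} = ℤP.≤-refl
≤₊-refl {+∞}     = tt

≤₊-reflexive : ∀ {u v} → u ≡ v → u ≤₊ v
≤₊-reflexive refl = ≤₊-refl

≤₊-trans : ∀ {u v w} → u ≤₊ v → v ≤₊ w → u ≤₊ w
≤₊-trans {w = +∞}                   _ _ = tt
≤₊-trans {fin₊ a} {fin₊ b} {fin₊ c} p q = ℤP.≤-trans p q
≤₊-trans {fin₊ a} {+∞}     {fin₊ c} _ ()
≤₊-trans {+∞}     {+∞}     {fin₊ c} _ ()

≤₊-antisym : ∀ {u v} → u ≤₊ v → v ≤₊ u → u ≡ v
≤₊-antisym {fin₊ a} {fin₊ b} p q = cong fin₊ (ℤP.≤-antisym p q)
≤₊-antisym {+∞}     {+∞}     _ _ = refl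

≤₊-preorder : Preorder 0ℓ 0ℓ 0ℓ
≤₊-preorder = record
  { Carrier = ℤ₊ ; _≈_ = _≡_ ; _≲_ = _≤₊_
  ; isPreorder = record { isEquivalence = isEquivalence ; reflexive = ≤₊-reflexive ; trans = ≤₊-trans } }

module ≤₊-Reasoning = PreorderReasoning ≤₊-preorder

+₊-mono-≤ : ∀ {u u′ v v′} → u ≤₊ u′ → v ≤₊ v′ → u +₊ v ≤₊ u′ +₊ v′
+₊-mono-≤ {u′ = +∞}                             _ _ = tt
+₊-mono-≤ {u′ = fin₊ _} {v′ = +∞}               _ _ = tt
+₊-mono-≤ {fin₊ a} {fin₊ a′} {fin₊ b} {fin₊ b′} p q = ℤP.+-mono-≤ p q

+₊-monoˡ-≤ : ∀ v {u u′} → u ≤₊ u′ → u +₊ v ≤₊ u′ +₊ v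
+₊-monoˡ-≤ v p = +₊-mono-≤ p (≤₊-refl {v})

+₊-monoʳ-≤ : ∀ u {v v′} → v ≤₊ v′ → u +₊ v ≤₊ u +₊ v′
+₊-monoʳ-≤ u p = +₊-mono-≤ (≤₊-refl {u}) p

≤⁎⇒slack : ∀ {a u} → a ≤⁎ u → 0₊ ≤₊ u +₊ neg a
≤⁎⇒slack { -∞}    {fin₊ _} _ = tt
≤⁎⇒slack { -∞}    {+∞}     _ = tt
≤⁎⇒slack {fin₋ c} {fin₊ d} p = ℤP.i≤j⇒0≤j-i p
≤⁎⇒slack {fin₋ c} {+∞}     _ = tt

slack⇒≤⁎ : ∀ {a u} → 0₊ ≤₊ u +₊ neg a → a ≤⁎ u
slack⇒≤⁎ { -∞}               _ = tt
slack⇒≤⁎ {fin₋ c} {fin₊ d} p = ℤP.0≤i-j⇒j≤i p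
slack⇒≤⁎ {fin₋ c} {+∞}     _ = tt

fin-≤⁎⇒≤₊ : ∀ {a u} → fin₋ a ≤⁎ u → fin₊ a ≤₊ u
fin-≤⁎⇒≤₊ {u = fin₊ _} p = p
fin-≤⁎⇒≤₊ {u = +∞}     _ = tt

≤₊⇒fin-≤⁎ : ∀ {a u} → fin₊ a ≤₊ u → fin₋ a ≤⁎ u
≤₊⇒fin-≤⁎ {u = fin₊ _} p = p
≤₊⇒fin-≤⁎ {u = +∞}     _ = tt

slack⇒≤₊ : ∀ {a u} → 0₊ ≤₊ u +₊ fin₊ (ℤ.- a) → fin₊ a ≤₊ u
slack⇒≤₊ = fin-≤⁎⇒≤₊ ∘ slack⇒≤⁎

between : ∀ ℓ u → 0₊ ≤₊ ℓ +₊ u → Σ ℤ λ α → 0₊ ≤₊ fin₊ α +₊ ℓ × 0₊ ≤₊ u +₊ fin₊ (ℤ.- α)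
between (fin₊ a) u p =
  ℤ.- a , ≤₊-reflexive (sym (cong fin₊ (ℤP.+-inverseˡ a)))
        , subst (λ c → 0₊ ≤₊ u +₊ fin₊ c) (sym (ℤP.neg-involutive a)) (subst (0₊ ≤₊_) (+₊-comm (fin₊ a) u) p)
between +∞ (fin₊ c) _ = c , tt , ≤₊-reflexive (sym (fin₊-inverseʳ c))
between +∞ +∞       _ = + 0 , tt , tt

_⊓₊_ : ℤ₊ → ℤ₊ → ℤ₊
fin₊ a ⊓₊ fin₊ b = fin₊ (a ℤ.⊓ b)
fin₊ a ⊓₊ +∞     = fin₊ a
+∞     ⊓₊ v      = v

⊓₊-sel : ∀ u v → u ⊓₊ v ≡ u ⊎ u ⊓₊ v ≡ v
⊓₊-sel (fin₊ a) (fin₊ b) = [ inj₁ ∘ cong fin₊ , inj₂ ∘ cong fin₊ ]′ (ℤP.⊓-sel a b)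
⊓₊-sel (fin₊ a) +∞       = inj₁ refl
⊓₊-sel +∞       v        = inj₂ refl

⊓₊-elim : ∀ (P : ℤ₊ → Set) {u v} → P u → P v → P (u ⊓₊ v)
⊓₊-elim P {u} {v} pu pv = [ (λ e → subst P (sym e) pu) , (λ e → subst P (sym e) pv) ]′ (⊓₊-sel u v)

⊓₊-≤ˡ : ∀ u v → u ⊓₊ v ≤₊ u
⊓₊-≤ˡ (fin₊ a) (fin₊ b) = ℤP.i⊓j≤i a b
⊓₊-≤ˡ (fin₊ a) +∞       = ℤP.≤-refl
⊓₊-≤ˡ +∞       v        = tt

⊓₊-≤ʳ : ∀ u v → u ⊓₊ v ≤₊ v
⊓₊-≤ʳ (fin₊ a) (fin₊ b) = ℤP.i⊓j≤j a b
⊓₊-≤ʳ (fin₊ a) +∞       = tt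
⊓₊-≤ʳ +∞       v        = ≤₊-refl

⊓₊-glb : ∀ {u v w} → w ≤₊ u → w ≤₊ v → w ≤₊ u ⊓₊ v
⊓₊-glb = ⊓₊-elim (_ ≤₊_)

⊓₊-eqˡ : ∀ {u v} → u ≤₊ v → u ⊓₊ v ≡ u
⊓₊-eqˡ {u} {v} p = ≤₊-antisym (⊓₊-≤ˡ u v) (⊓₊-glb ≤₊-refl p)

⊓₊-eqʳ : ∀ {u v} → v ≤₊ u → u ⊓₊ v ≡ v
⊓₊-eqʳ {u} {v} p = ≤₊-antisym (⊓₊-≤ʳ u v) (⊓₊-glb p ≤₊-refl)

when : Bool → ℤ₊ → ℤ₊
when true  u = u
when false _ = 0₊

when-0₊ : ∀ s → when s 0₊ ≡ 0₊
when-0₊ false = refl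
when-0₊ true  = refl

when-∧-∨ : ∀ s t u → when (s ∧ t) u +₊ when (s ∨ t) u ≡ when s u +₊ when t u
when-∧-∨ false false u = refl
when-∧-∨ false true  u = refl
when-∧-∨ true  false u = +₊-comm 0₊ u
when-∧-∨ true  true  u = refl

i+[j-i]≡j : ∀ i j → i ℤ.+ (j ℤ.- i) ≡ j
i+[j-i]≡j = solve-∀

-[i-j]≡-i+j : ∀ i j → ℤ.- (i ℤ.- j) ≡ ℤ.- i ℤ.+ j
-[i-j]≡-i+j = solve-∀

[-i+-i]+i≡-i : ∀ i → (ℤ.- i ℤ.+ ℤ.- i) ℤ.+ i ≡ ℤ.- i
[-i+-i]+i≡-i = solve-∀

[-i+0]+i≡0 : ∀ i → (ℤ.- i ℤ.+ + 0) ℤ.+ i ≡ + 0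
[-i+0]+i≡0 = solve-∀

[0+-i]+i≡0 : ∀ i → (+ 0 ℤ.+ ℤ.- i) ℤ.+ i ≡ + 0
[0+-i]+i≡0 = solve-∀

-- Subsets and modular extensions

∁-involutive : ∀ {n} (X : Subset n) → ∁ (∁ X) ≡ X
∁-involutive X = trans (sym (map-∘ not not X)) (trans (map-cong not-involutive X) (map-id X))

∁⊤≡⊥ : ∀ {n} → ∁ (⊤ {n}) ≡ ⊥
∁⊤≡⊥ = trans (sym (∩-identityʳ (∁ ⊤))) (∩-inverseˡ ⊤)

─≡∩∁ : ∀ {n} (X Y : Subset n) → X ─ Y ≡ X ∩ ∁ Y
─≡∩∁ []            []            = refl
─≡∩∁ (inside  ∷ X) (inside  ∷ Y) = cong (outside ∷_) (─≡∩∁ X Y)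
─≡∩∁ (inside  ∷ X) (outside ∷ Y) = cong (inside ∷_) (─≡∩∁ X Y)
─≡∩∁ (outside ∷ X) (inside  ∷ Y) = cong (outside ∷_) (─≡∩∁ X Y)
─≡∩∁ (outside ∷ X) (outside ∷ Y) = cong (outside ∷_) (─≡∩∁ X Y)

⊤─≡∁ : ∀ {n} (Z : Subset n) → ⊤ ─ Z ≡ ∁ Z
⊤─≡∁ Z = trans (─≡∩∁ ⊤ Z) (∩-identityˡ (∁ Z))

tilde₊-∷ : ∀ {n} (h : Fin (suc n) → ℤ₊) s Z → tilde₊ h (s ∷ Z) ≡ when s (h fzero) +₊ tilde₊ (tail h) Z
tilde₊-∷ h true  Z = refl
tilde₊-∷ h false Z = sym (+₊-identityˡ _)

tilde₊-⊥ : ∀ {n} (h : Fin n → ℤ₊) → tilde₊ h ⊥ ≡ 0₊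
tilde₊-⊥ {zero}  h = refl
tilde₊-⊥ {suc n} h = tilde₊-⊥ (tail h)

neg-tilde₋ : ∀ {n} (f : Fin n → ℤ₋) Z → neg (tilde₋ f Z) ≡ tilde₊ (neg ∘ f) Z
neg-tilde₋ {zero}  f []            = refl
neg-tilde₋ {suc n} f (inside  ∷ Z) = trans (neg-+ (f fzero) _) (cong (neg (f fzero) +₊_) (neg-tilde₋ (tail f) Z))
neg-tilde₋ {suc n} f (outside ∷ Z) = neg-tilde₋ (tail f) Z

fin₊-tildeℤ : ∀ {n} (x : Fin n → ℤ) Z → fin₊ (tildeℤ x Z) ≡ tilde₊ (fin₊ ∘ x) Z
fin₊-tildeℤ {zero}  x []            = refl
fin₊-tildeℤ {suc n} x (inside  ∷ Z) = cong (fin₊ (x fzero) +₊_) (fin₊-tildeℤ (tail x) Z)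
fin₊-tildeℤ {suc n} x (outside ∷ Z) = fin₊-tildeℤ (tail x) Z

tildeℤ-+-∁ : ∀ {n} (x : Fin n → ℤ) Z → tildeℤ x Z ℤ.+ tildeℤ x (∁ Z) ≡ tildeℤ x ⊤
tildeℤ-+-∁ {zero}  x []            = refl
tildeℤ-+-∁ {suc n} x (inside  ∷ Z) =
  trans (ℤP.+-assoc (x fzero) _ _) (cong (λ t → x fzero ℤ.+ t) (tildeℤ-+-∁ (tail x) Z))
tildeℤ-+-∁ {suc n} x (outside ∷ Z) =
  trans (x∙yz≈y∙xz (tildeℤ (tail x) Z) (x fzero) _) (cong (λ t → x fzero ℤ.+ t) (tildeℤ-+-∁ (tail x) Z))
  where open CommutativeSemigroupProperties ℤP.+-commutativeSemigroup using (x∙yz≈y∙xz)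

⨅ : ∀ {n} → (Subset n → ℤ₊) → ℤ₊
⨅ {zero}  h = h []
⨅ {suc n} h = ⨅ (λ X → h (outside ∷ X)) ⊓₊ ⨅ (λ X → h (inside ∷ X))

⨅-≤ : ∀ {n} (h : Subset n → ℤ₊) X → ⨅ h ≤₊ h X
⨅-≤ {zero}  h []            = ≤₊-refl
⨅-≤ {suc n} h (outside ∷ X) = ≤₊-trans (⊓₊-≤ˡ _ _) (⨅-≤ (λ X → h (outside ∷ X)) X)
⨅-≤ {suc n} h (inside  ∷ X) = ≤₊-trans (⊓₊-≤ʳ _ _) (⨅-≤ (λ X → h (inside ∷ X)) X)

⨅-elim : ∀ {n} (P : ℤ₊ → Set) (h : Subset n → ℤ₊) → (∀ X → P (h X)) → P (⨅ h)
⨅-elim {zero}  P h p = p []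
⨅-elim {suc n} P h p = ⊓₊-elim P (⨅-elim P _ (λ X → p (outside ∷ X))) (⨅-elim P _ (λ X → p (inside ∷ X)))

⨅² : ∀ {n} → (Subset n → Subset n → ℤ₊) → ℤ₊
⨅² h = ⨅ (λ X → ⨅ (h X))

⨅²-≤ : ∀ {n} (h : Subset n → Subset n → ℤ₊) X Y → ⨅² h ≤₊ h X Y
⨅²-≤ h X Y = ≤₊-trans (⨅-≤ (λ X → ⨅ (h X)) X) (⨅-≤ (h X) Y)

⨅²-elim : ∀ {n} (P : ℤ₊ → Set) (h : Subset n → Subset n → ℤ₊) → (∀ X Y → P (h X Y)) → P (⨅² h)
⨅²-elim P h p = ⨅-elim P (λ X → ⨅ (h X)) λ X → ⨅-elim P (h X) (p X)

-- Uncrossing inequalities for modular functions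

tilde₊-∷-quad : ∀ {n} (h₁ h₂ h₃ h₄ : Fin (suc n) → ℤ₊) p q r s P Q R S →
  (tilde₊ h₁ (p ∷ P) +₊ tilde₊ h₂ (q ∷ Q)) +₊ (tilde₊ h₃ (r ∷ R) +₊ tilde₊ h₄ (s ∷ S))
  ≡ ((when p (h₁ fzero) +₊ when q (h₂ fzero)) +₊ (when r (h₃ fzero) +₊ when s (h₄ fzero)))
    +₊ ((tilde₊ (tail h₁) P +₊ tilde₊ (tail h₂) Q) +₊ (tilde₊ (tail h₃) R +₊ tilde₊ (tail h₄) S))
tilde₊-∷-quad h₁ h₂ h₃ h₄ p q r s P Q R S = begin
  (tilde₊ h₁ (p ∷ P) +₊ tilde₊ h₂ (q ∷ Q)) +₊ (tilde₊ h₃ (r ∷ R) +₊ tilde₊ h₄ (s ∷ S))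
    ≡⟨ cong₂ _+₊_ (cong₂ _+₊_ (tilde₊-∷ h₁ p P) (tilde₊-∷ h₂ q Q)) (cong₂ _+₊_ (tilde₊-∷ h₃ r R) (tilde₊-∷ h₄ s S)) ⟩
  ((w₁ +₊ t₁) +₊ (w₂ +₊ t₂)) +₊ ((w₃ +₊ t₃) +₊ (w₄ +₊ t₄))
    ≡⟨ cong₂ _+₊_ (interchange w₁ t₁ w₂ t₂) (interchange w₃ t₃ w₄ t₄) ⟩
  ((w₁ +₊ w₂) +₊ (t₁ +₊ t₂)) +₊ ((w₃ +₊ w₄) +₊ (t₃ +₊ t₄))
    ≡⟨ interchange (w₁ +₊ w₂) (t₁ +₊ t₂) (w₃ +₊ w₄) (t₃ +₊ t₄) ⟩
  ((w₁ +₊ w₂) +₊ (w₃ +₊ w₄)) +₊ ((t₁ +₊ t₂) +₊ (t₃ +₊ t₄)) ∎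
  where
  open ≡-Reasoning
  w₁ = when p (h₁ fzero)
  w₂ = when q (h₂ fzero)
  w₃ = when r (h₃ fzero)
  w₄ = when s (h₄ fzero)
  t₁ = tilde₊ (tail h₁) P
  t₂ = tilde₊ (tail h₂) Q
  t₃ = tilde₊ (tail h₃) R
  t₄ = tilde₊ (tail h₄) S

-- In each case the two sides agree up to order, or the right side exceeds the left by g₀ + F₀ ≥ 0.
uncross-element : ∀ g₀ F₀ → 0₊ ≤₊ g₀ +₊ F₀ → ∀ a b c d →
  (when (not (a ∧ c) ∧ not (b ∨ d)) g₀ +₊ when (not (a ∨ c) ∧ not (b ∧ d)) g₀)
    +₊ (when ((a ∧ c) ∧ (b ∨ d)) F₀ +₊ when ((a ∨ c) ∧ (b ∧ d)) F₀)
  ≤₊ (when (not a ∧ not b) g₀ +₊ when (not c ∧ not d) g₀) +₊ (when (a ∧ b) F₀ +₊ when (c ∧ d) F₀)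
uncross-element g₀ F₀ _     false false false false = ≤₊-refl
uncross-element g₀ F₀ _     false false false true  = ≤₊-reflexive (cong (_+₊ 0₊) (+₊-comm 0₊ g₀))
uncross-element g₀ F₀ _     false false true  false = ≤₊-refl
uncross-element g₀ F₀ 0≤g+F false false true  true  =
  subst (0₊ ≤₊_) (sym (cong₂ _+₊_ (+₊-identityʳ g₀) (+₊-identityˡ F₀))) 0≤g+F
uncross-element g₀ F₀ _     false true  false false = ≤₊-refl
uncross-element g₀ F₀ _     false true  false true  = ≤₊-refl
uncross-element g₀ F₀ _     false true  true  false = ≤₊-refl
uncross-element g₀ F₀ _     false true  true  true  = ≤₊-refl
uncross-element g₀ F₀ _     true  false false false = ≤₊-reflexive (cong (_+₊ 0₊) (+₊-comm g₀ 0₊))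
uncross-element g₀ F₀ _     true  false false true  = ≤₊-refl
uncross-element g₀ F₀ _     true  false true  false = ≤₊-refl
uncross-element g₀ F₀ _     true  false true  true  = ≤₊-reflexive (cong (0₊ +₊_) (+₊-comm F₀ 0₊))
uncross-element g₀ F₀ 0≤g+F true  true  false false =
  subst (0₊ ≤₊_) (sym (cong₂ _+₊_ (+₊-identityˡ g₀) (+₊-identityʳ F₀))) 0≤g+F
uncross-element g₀ F₀ _     true  true  false true  = ≤₊-reflexive (cong (0₊ +₊_) (+₊-comm 0₊ F₀))
uncross-element g₀ F₀ _     true  true  true  false = ≤₊-refl
uncross-element g₀ F₀ _     true  true  true  true  = ≤₊-refl

tilde₊-uncross : ∀ {n} (g F : Fin n → ℤ₊) → (∀ s → 0₊ ≤₊ g s +₊ F s) → ∀ A B C D →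
  (tilde₊ g (∁ (A ∩ C) ∩ ∁ (B ∪ D)) +₊ tilde₊ g (∁ (A ∪ C) ∩ ∁ (B ∩ D)))
    +₊ (tilde₊ F ((A ∩ C) ∩ (B ∪ D)) +₊ tilde₊ F ((A ∪ C) ∩ (B ∩ D)))
  ≤₊ (tilde₊ g (∁ A ∩ ∁ B) +₊ tilde₊ g (∁ C ∩ ∁ D)) +₊ (tilde₊ F (A ∩ B) +₊ tilde₊ F (C ∩ D))
tilde₊-uncross {zero}  g F 0≤g+F [] [] [] [] = ≤₊-refl
tilde₊-uncross {suc n} g F 0≤g+F (a ∷ A) (b ∷ B) (c ∷ C) (d ∷ D) =
  subst₂ _≤₊_ (sym (tilde₊-∷-quad g g F F _ _ _ _ _ _ _ _)) (sym (tilde₊-∷-quad g g F F _ _ _ _ _ _ _ _))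
    (+₊-mono-≤ (uncross-element (g fzero) (F fzero) (0≤g+F fzero) a b c d)
               (tilde₊-uncross (tail g) (tail F) (0≤g+F ∘ fsuc) A B C D))

box-element : ∀ {h₀ g₀ F₀} → h₀ ≤₊ g₀ → 0₊ ≤₊ h₀ +₊ F₀ → ∀ a b →
  h₀ ≤₊ (when a h₀ +₊ when b h₀) +₊ (when (not a ∧ not b) g₀ +₊ when (a ∧ b) F₀)
box-element {g₀ = g₀} h≤g _ false false = ≤₊-trans h≤g (≤₊-reflexive (sym (trans (+₊-identityˡ _) (+₊-identityʳ g₀))))
box-element {h₀} _ _ false true  = ≤₊-reflexive (sym (trans (+₊-identityʳ _) (+₊-identityˡ h₀)))
box-element {h₀} _ _ true  false = ≤₊-reflexive (sym (trans (+₊-identityʳ _) (+₊-identityʳ h₀)))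
box-element {h₀} {F₀ = F₀} _ 0≤h+F true true = begin
  h₀                        ≡⟨ sym (+₊-identityʳ h₀) ⟩
  h₀ +₊ 0₊                  ≲⟨ +₊-monoʳ-≤ h₀ 0≤h+F ⟩
  h₀ +₊ (h₀ +₊ F₀)          ≡⟨ sym (+₊-assoc h₀ h₀ F₀) ⟩
  (h₀ +₊ h₀) +₊ F₀          ≡⟨ cong ((h₀ +₊ h₀) +₊_) (sym (+₊-identityˡ F₀)) ⟩
  (h₀ +₊ h₀) +₊ (0₊ +₊ F₀)  ∎
  where open ≤₊-Reasoning

tilde₊-box : ∀ {n} (h g F : Fin n → ℤ₊) → (∀ s → h s ≤₊ g s) → (∀ s → 0₊ ≤₊ h s +₊ F s) → ∀ X Y →
  tilde₊ h ⊤ ≤₊ (tilde₊ h X +₊ tilde₊ h Y) +₊ (tilde₊ g (∁ X ∩ ∁ Y) +₊ tilde₊ F (X ∩ Y))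
tilde₊-box {zero}  h g F _ _ [] [] = ≤₊-refl
tilde₊-box {suc n} h g F h≤g 0≤h+F (a ∷ X) (b ∷ Y) =
  subst (tilde₊ h ⊤ ≤₊_) (sym (tilde₊-∷-quad h h g F _ _ _ _ _ _ _ _))
    (+₊-mono-≤ (box-element (h≤g fzero) (0≤h+F fzero) a b)
               (tilde₊-box (tail h) (tail g) (tail F) (h≤g ∘ fsuc) (0≤h+F ∘ fsuc) X Y))

-- Fixing the first coordinate

-- The bound on y(Z) for the remaining coordinates once x₀ = α: both y(Z) ≤ b(Z) and α + y(Z) ≤ b(Z + 0).
fixHead : ∀ {n} → (Subset (suc n) → ℤ₊) → ℤ → Subset n → ℤ₊
fixHead b α Z = b (outside ∷ Z) ⊓₊ (b (inside ∷ Z) +₊ fin₊ (ℤ.- α))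

fixHead-≤ : ∀ {n} (b : Subset (suc n) → ℤ₊) α s Z → fixHead b α Z ≤₊ b (s ∷ Z) +₊ when s (fin₊ (ℤ.- α))
fixHead-≤ b α false Z = ≤₊-trans (⊓₊-≤ˡ _ _) (≤₊-reflexive (sym (+₊-identityʳ _)))
fixHead-≤ b α true  Z = ⊓₊-≤ʳ _ _

fixHead-attained : ∀ {n} (b : Subset (suc n) → ℤ₊) α Z →
  Σ Bool λ s → fixHead b α Z ≡ b (s ∷ Z) +₊ when s (fin₊ (ℤ.- α))
fixHead-attained b α Z =
  ⊓₊-elim (λ v → Σ Bool λ s → v ≡ b (s ∷ Z) +₊ when s (fin₊ (ℤ.- α))) (false , sym (+₊-identityʳ _)) (true , refl)

fixHead-submodular : ∀ {n} {b : Subset (suc n) → ℤ₊} → FullySubmodular b → ∀ α → FullySubmodular (fixHead b α)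
fixHead-submodular {b = b} sub α X Y with fixHead-attained b α X | fixHead-attained b α Y
... | s , eX | t , eY = begin
  fixHead b α (X ∩ Y) +₊ fixHead b α (X ∪ Y)
    ≲⟨ +₊-mono-≤ (fixHead-≤ b α (s ∧ t) (X ∩ Y)) (fixHead-≤ b α (s ∨ t) (X ∪ Y)) ⟩
  (b ((s ∧ t) ∷ X ∩ Y) +₊ c (s ∧ t)) +₊ (b ((s ∨ t) ∷ X ∪ Y) +₊ c (s ∨ t))
    ≡⟨ interchange _ _ _ _ ⟩
  (b ((s ∧ t) ∷ X ∩ Y) +₊ b ((s ∨ t) ∷ X ∪ Y)) +₊ (c (s ∧ t) +₊ c (s ∨ t))
    ≲⟨ +₊-mono-≤ (sub (s ∷ X) (t ∷ Y)) (≤₊-reflexive (when-∧-∨ s t _)) ⟩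
  (b (s ∷ X) +₊ b (t ∷ Y)) +₊ (c s +₊ c t)
    ≡⟨ interchange _ _ _ _ ⟩
  (b (s ∷ X) +₊ c s) +₊ (b (t ∷ Y) +₊ c t)
    ≡⟨ sym (cong₂ _+₊_ eX eY) ⟩
  fixHead b α X +₊ fixHead b α Y ∎
  where
  open ≤₊-Reasoning
  c : Bool → ℤ₊
  c s = when s (fin₊ (ℤ.- α))

fixHead-⊥ : ∀ {n} (b : Subset (suc n) → ℤ₊) {α} → b ⊥ ≡ 0₊ → 0₊ ≤₊ b (inside ∷ ⊥) +₊ fin₊ (ℤ.- α) →
  fixHead b α ⊥ ≡ 0₊
fixHead-⊥ b {α} b⊥ p = trans (cong (_⊓₊ (b (inside ∷ ⊥) +₊ fin₊ (ℤ.- α))) b⊥) (⊓₊-eqˡ p)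

fixHead-⊤ : ∀ {n} (b : Subset (suc n) → ℤ₊) {α H} → b ⊤ ≡ fin₊ H →
  0₊ ≤₊ fin₊ α +₊ (b (outside ∷ ⊤) +₊ fin₊ (ℤ.- H)) → fixHead b α ⊤ ≡ fin₊ (H ℤ.- α)
fixHead-⊤ b {α} {H} b⊤ p =
  trans (cong (λ v → b (outside ∷ ⊤) ⊓₊ (v +₊ fin₊ (ℤ.- α))) b⊤) (⊓₊-eqʳ (slack⇒≤₊ p′))
  where
  p′ : 0₊ ≤₊ b (outside ∷ ⊤) +₊ fin₊ (ℤ.- (H ℤ.- α))
  p′ = subst (0₊ ≤₊_)
    (trans (solve 3 (λ a u h → a ⊕ (u ⊕ h) ⊜ u ⊕ (h ⊕ a)) refl (fin₊ α) (b (outside ∷ ⊤)) (fin₊ (ℤ.- H)))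
           (cong (λ z → b (outside ∷ ⊤) +₊ fin₊ z) (sym (-[i-j]≡-i+j H α))))
    p

∷-≤-fixHead : ∀ {n} {b : Subset (suc n) → ℤ₊} {α} {y : Fin n → ℤ} →
  (∀ Z → fin₊ (tildeℤ y Z) ≤₊ fixHead b α Z) → ∀ Z → fin₊ (tildeℤ (α Vector.∷ y) Z) ≤₊ b Z
∷-≤-fixHead y≤ (outside ∷ Z) = ≤₊-trans (y≤ Z) (⊓₊-≤ˡ _ _)
∷-≤-fixHead {b = b} {α} {y} y≤ (inside ∷ Z) = begin
  fin₊ α +₊ fin₊ (tildeℤ y Z)                ≲⟨ +₊-monoʳ-≤ (fin₊ α) (≤₊-trans (y≤ Z) (⊓₊-≤ʳ _ _)) ⟩
  fin₊ α +₊ (b (inside ∷ Z) +₊ fin₊ (ℤ.- α)) ≡⟨ solve 3 (λ a u m → a ⊕ (u ⊕ m) ⊜ (u ⊕ a) ⊕ m) refl (fin₊ α) _ _ ⟩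
  b (inside ∷ Z) +₊ fin₊ α +₊ fin₊ (ℤ.- α)   ≡⟨ +₊-cancel-fin _ α ⟩
  b (inside ∷ Z)                             ∎
  where open ≤₊-Reasoning

-- The surplus of a pair of sets

-- F plays the role of −f, so that all bounds live in ℤ ∪ {+∞}.
surplus : ∀ {n} → (b₁ b₂ : Subset n → ℤ₊) (g F : Fin n → ℤ₊) → ℤ → Subset n → Subset n → ℤ₊
surplus b₁ b₂ g F H X Y = b₁ X +₊ b₂ Y +₊ tilde₊ g (∁ X ∩ ∁ Y) +₊ tilde₊ F (X ∩ Y) +₊ fin₊ (ℤ.- H)

surplus-comm : ∀ {n} (b₁ b₂ : Subset n → ℤ₊) g F H X Y → surplus b₁ b₂ g F H X Y ≡ surplus b₂ b₁ g F H Y X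
surplus-comm b₁ b₂ g F H X Y rewrite +₊-comm (b₁ X) (b₂ Y) | ∩-comm (∁ X) (∁ Y) | ∩-comm X Y = refl

surplus-∷ : ∀ {n} (b₁ b₂ : Subset (suc n) → ℤ₊) g F H s t A B →
  surplus b₁ b₂ g F H (s ∷ A) (t ∷ B)
  ≡ (when (not s ∧ not t) (g fzero) +₊ when (s ∧ t) (F fzero))
    +₊ surplus (b₁ ∘ (s ∷_)) (b₂ ∘ (t ∷_)) (tail g) (tail F) H A B
surplus-∷ b₁ b₂ g F H s t A B = begin
  b₁ (s ∷ A) +₊ b₂ (t ∷ B) +₊ tilde₊ g (∁ (s ∷ A) ∩ ∁ (t ∷ B)) +₊ tilde₊ F ((s ∷ A) ∩ (t ∷ B)) +₊ m
    ≡⟨ cong₂ (λ u v → b₁ (s ∷ A) +₊ b₂ (t ∷ B) +₊ u +₊ v +₊ m) (tilde₊-∷ g _ _) (tilde₊-∷ F _ _) ⟩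
  b₁ (s ∷ A) +₊ b₂ (t ∷ B) +₊ (wg +₊ G) +₊ (wF +₊ F′) +₊ m
    ≡⟨ solve 7 (λ x y wg G wF F′ m → (((x ⊕ y) ⊕ (wg ⊕ G)) ⊕ (wF ⊕ F′)) ⊕ m ⊜ (wg ⊕ wF) ⊕ ((((x ⊕ y) ⊕ G) ⊕ F′) ⊕ m))
         refl (b₁ (s ∷ A)) (b₂ (t ∷ B)) wg G wF F′ m ⟩
  (wg +₊ wF) +₊ (b₁ (s ∷ A) +₊ b₂ (t ∷ B) +₊ G +₊ F′ +₊ m) ∎
  where
  open ≡-Reasoning
  m  = fin₊ (ℤ.- H)
  wg = when (not s ∧ not t) (g fzero)
  wF = when (s ∧ t) (F fzero)
  G  = tilde₊ (tail g) (∁ A ∩ ∁ B)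
  F′ = tilde₊ (tail F) (A ∩ B)

surplus-headless : ∀ {n} (b₁ b₂ : Subset (suc n) → ℤ₊) (g F : Fin n → ℤ₊) H s t A B →
  surplus b₁ b₂ (0₊ Vector.∷ g) (0₊ Vector.∷ F) H (s ∷ A) (t ∷ B) ≡ surplus (b₁ ∘ (s ∷_)) (b₂ ∘ (t ∷_)) g F H A B
surplus-headless b₁ b₂ g F H s t A B =
  trans (surplus-∷ b₁ b₂ _ _ H s t A B)
        (trans (cong₂ (λ u v → u +₊ v +₊ tailSurplus) (when-0₊ (not s ∧ not t)) (when-0₊ (s ∧ t)))
               (+₊-identityˡ tailSurplus))
  where tailSurplus = surplus (b₁ ∘ (s ∷_)) (b₂ ∘ (t ∷_)) g F H A B

surplus-⊥⊤ : ∀ {n} (b₁ b₂ : Subset n → ℤ₊) g F H → surplus b₁ b₂ g F H ⊥ ⊤ ≡ b₁ ⊥ +₊ b₂ ⊤ +₊ fin₊ (ℤ.- H)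
surplus-⊥⊤ b₁ b₂ g F H = begin
  b₁ ⊥ +₊ b₂ ⊤ +₊ tilde₊ g (∁ ⊥ ∩ ∁ ⊤) +₊ tilde₊ F (⊥ ∩ ⊤) +₊ m
    ≡⟨ cong₂ (λ u v → b₁ ⊥ +₊ b₂ ⊤ +₊ u +₊ v +₊ m) g-vanishes F-vanishes ⟩
  b₁ ⊥ +₊ b₂ ⊤ +₊ 0₊ +₊ 0₊ +₊ m
    ≡⟨ cong (_+₊ m) (trans (+₊-identityʳ _) (+₊-identityʳ _)) ⟩
  b₁ ⊥ +₊ b₂ ⊤ +₊ m ∎
  where
  open ≡-Reasoning
  m = fin₊ (ℤ.- H)
  g-vanishes : tilde₊ g (∁ ⊥ ∩ ∁ ⊤) ≡ 0₊
  g-vanishes = trans (cong (λ Z → tilde₊ g (∁ ⊥ ∩ Z)) ∁⊤≡⊥) (trans (cong (tilde₊ g) (∩-zeroʳ (∁ ⊥))) (tilde₊-⊥ g))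
  F-vanishes : tilde₊ F (⊥ ∩ ⊤) ≡ 0₊
  F-vanishes = trans (cong (tilde₊ F) (∩-zeroˡ ⊤)) (tilde₊-⊥ F)

surplus-submodular : ∀ {n} {b₁ b₂ : Subset n → ℤ₊} {g F : Fin n → ℤ₊} H →
  FullySubmodular b₁ → FullySubmodular b₂ → (∀ s → 0₊ ≤₊ g s +₊ F s) → ∀ X₁ Y₁ X₂ Y₂ →
  surplus b₁ b₂ g F H (X₁ ∩ X₂) (Y₁ ∪ Y₂) +₊ surplus b₁ b₂ g F H (X₁ ∪ X₂) (Y₁ ∩ Y₂)
  ≤₊ surplus b₁ b₂ g F H X₁ Y₁ +₊ surplus b₁ b₂ g F H X₂ Y₂
surplus-submodular {b₁ = b₁} {b₂} {g} {F} H sub₁ sub₂ 0≤g+F X₁ Y₁ X₂ Y₂ = begin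
  surplus b₁ b₂ g F H (X₁ ∩ X₂) (Y₁ ∪ Y₂) +₊ surplus b₁ b₂ g F H (X₁ ∪ X₂) (Y₁ ∩ Y₂)
    ≡⟨ regroup _ _ _ _ _ _ _ _ m ⟩
  (b₁∩∪ +₊ (b₂ (Y₁ ∪ Y₂) +₊ b₂ (Y₁ ∩ Y₂))) +₊ uncrossed +₊ (m +₊ m)
    ≡⟨ cong (λ v → (b₁∩∪ +₊ v) +₊ uncrossed +₊ (m +₊ m)) (+₊-comm (b₂ (Y₁ ∪ Y₂)) _) ⟩
  (b₁∩∪ +₊ (b₂ (Y₁ ∩ Y₂) +₊ b₂ (Y₁ ∪ Y₂))) +₊ uncrossed +₊ (m +₊ m)
    ≲⟨ +₊-monoˡ-≤ (m +₊ m) (+₊-mono-≤ (+₊-mono-≤ (sub₁ X₁ X₂) (sub₂ Y₁ Y₂)) (tilde₊-uncross g F 0≤g+F X₁ Y₁ X₂ Y₂)) ⟩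
  ((b₁ X₁ +₊ b₁ X₂) +₊ (b₂ Y₁ +₊ b₂ Y₂)) +₊ crossed +₊ (m +₊ m)
    ≡⟨ sym (regroup _ _ _ _ _ _ _ _ m) ⟩
  surplus b₁ b₂ g F H X₁ Y₁ +₊ surplus b₁ b₂ g F H X₂ Y₂ ∎
  where
  open ≤₊-Reasoning
  m = fin₊ (ℤ.- H)
  b₁∩∪ = b₁ (X₁ ∩ X₂) +₊ b₁ (X₁ ∪ X₂)
  uncrossed = (tilde₊ g (∁ (X₁ ∩ X₂) ∩ ∁ (Y₁ ∪ Y₂)) +₊ tilde₊ g (∁ (X₁ ∪ X₂) ∩ ∁ (Y₁ ∩ Y₂)))
              +₊ (tilde₊ F ((X₁ ∩ X₂) ∩ (Y₁ ∪ Y₂)) +₊ tilde₊ F ((X₁ ∪ X₂) ∩ (Y₁ ∩ Y₂)))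
  crossed = (tilde₊ g (∁ X₁ ∩ ∁ Y₁) +₊ tilde₊ g (∁ X₂ ∩ ∁ Y₂)) +₊ (tilde₊ F (X₁ ∩ Y₁) +₊ tilde₊ F (X₂ ∩ Y₂))
  regroup : ∀ a₁ c₁ G₁ F₁ a₂ c₂ G₂ F₂ m →
    (a₁ +₊ c₁ +₊ G₁ +₊ F₁ +₊ m) +₊ (a₂ +₊ c₂ +₊ G₂ +₊ F₂ +₊ m)
    ≡ ((a₁ +₊ a₂) +₊ (c₁ +₊ c₂)) +₊ ((G₁ +₊ G₂) +₊ (F₁ +₊ F₂)) +₊ (m +₊ m)
  regroup = solve 9 (λ a₁ c₁ G₁ F₁ a₂ c₂ G₂ F₂ m →
    ((((a₁ ⊕ c₁) ⊕ G₁) ⊕ F₁) ⊕ m) ⊕ ((((a₂ ⊕ c₂) ⊕ G₂) ⊕ F₂) ⊕ m)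
    ⊜ (((a₁ ⊕ a₂) ⊕ (c₁ ⊕ c₂)) ⊕ ((G₁ ⊕ G₂) ⊕ (F₁ ⊕ F₂))) ⊕ (m ⊕ m)) refl

surplus-shift : ∀ {n} {b₁ b₂ b₁′ b₂′ : Subset n → ℤ₊} (g F : Fin n → ℤ₊) H α {X Y c₁ c₂} →
  b₁′ X ≡ b₁ X +₊ c₁ → b₂′ Y ≡ b₂ Y +₊ c₂ →
  surplus b₁′ b₂′ g F (H ℤ.- α) X Y ≡ surplus b₁ b₂ g F H X Y +₊ (c₁ +₊ c₂ +₊ fin₊ α)
surplus-shift {b₁ = b₁} {b₂} g F H α {X} {Y} {c₁} {c₂} e₁ e₂ rewrite e₁ | e₂ | -[i-j]≡-i+j H α =
  solve 8 (λ x c₁ y c₂ G F′ m a →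
    ((((x ⊕ c₁) ⊕ (y ⊕ c₂)) ⊕ G) ⊕ F′) ⊕ (m ⊕ a) ⊜ ((((x ⊕ y) ⊕ G) ⊕ F′) ⊕ m) ⊕ ((c₁ ⊕ c₂) ⊕ a))
    refl (b₁ X) c₁ (b₂ Y) c₂ (tilde₊ g (∁ X ∩ ∁ Y)) (tilde₊ F (X ∩ Y)) (fin₊ (ℤ.- H)) (fin₊ α)

-- Intersection of two base polyhedra with a box

record Problem (n : ℕ) : Set where
  field
    b₁ b₂          : Subset n → ℤ₊
    g F            : Fin n → ℤ₊
    H              : ℤ
    b₁-submodular  : FullySubmodular b₁
    b₂-submodular  : FullySubmodular b₂
    b₁-⊥           : b₁ ⊥ ≡ 0₊
    b₂-⊥           : b₂ ⊥ ≡ 0₊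
    b₁-⊤           : b₁ ⊤ ≡ fin₊ H
    b₂-⊤           : b₂ ⊤ ≡ fin₊ H
    0≤g+F          : ∀ s → 0₊ ≤₊ g s +₊ F s
    surplus-nonneg : ∀ X Y → 0₊ ≤₊ surplus b₁ b₂ g F H X Y

record Solution {n} (P : Problem n) : Set where
  open Problem P
  field
    x     : Fin n → ℤ
    sum≡H : tildeℤ x ⊤ ≡ H
    x≤b₁  : ∀ Z → fin₊ (tildeℤ x Z) ≤₊ b₁ Z
    x≤b₂  : ∀ Z → fin₊ (tildeℤ x Z) ≤₊ b₂ Z
    x≤g   : ∀ s → fin₊ (x s) ≤₊ g s
    -F≤x  : ∀ s → 0₊ ≤₊ fin₊ (x s) +₊ F s

solution₀ : (P : Problem 0) → Solution P
solution₀ P = record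
  { x     = λ ()
  ; sum≡H = fin₊-injective (trans (sym b₁-⊥) b₁-⊤)
  ; x≤b₁  = λ { [] → ≤₊-reflexive (sym b₁-⊥) }
  ; x≤b₂  = λ { [] → ≤₊-reflexive (sym b₂-⊥) }
  ; x≤g   = λ ()
  ; -F≤x  = λ ()
  }
  where open Problem P

module Step {n} (P : Problem (suc n)) where
  open Problem P

  tailSurplus : Bool → Bool → Subset n → Subset n → ℤ₊
  tailSurplus s t = surplus (b₁ ∘ (s ∷_)) (b₂ ∘ (t ∷_)) (tail g) (tail F) H

  surplus-nonneg-∷ : ∀ s t A B →
    0₊ ≤₊ (when (not s ∧ not t) (g fzero) +₊ when (s ∧ t) (F fzero)) +₊ tailSurplus s t A B
  surplus-nonneg-∷ s t A B = subst (0₊ ≤₊_) (surplus-∷ b₁ b₂ g F H s t A B) (surplus-nonneg (s ∷ A) (t ∷ B))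

  tf-nonneg : ∀ A B → 0₊ ≤₊ tailSurplus true false A B
  tf-nonneg A B = subst (0₊ ≤₊_) (+₊-identityˡ _) (surplus-nonneg-∷ true false A B)

  ft-nonneg : ∀ A B → 0₊ ≤₊ tailSurplus false true A B
  ft-nonneg A B = subst (0₊ ≤₊_) (+₊-identityˡ _) (surplus-nonneg-∷ false true A B)

  F+g-nonneg : 0₊ ≤₊ F fzero +₊ g fzero
  F+g-nonneg = subst (0₊ ≤₊_) (+₊-comm _ _) (0≤g+F fzero)

  F+tt-nonneg : ∀ C D → 0₊ ≤₊ F fzero +₊ tailSurplus true true C D
  F+tt-nonneg C D =
    subst (0₊ ≤₊_) (cong (_+₊ tailSurplus true true C D) (+₊-identityˡ _)) (surplus-nonneg-∷ true true C D)

  ff+g-nonneg : ∀ A B → 0₊ ≤₊ tailSurplus false false A B +₊ g fzero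
  ff+g-nonneg A B = subst (0₊ ≤₊_) (trans (cong (_+₊ tailSurplus false false A B) (+₊-identityʳ _)) (+₊-comm _ _))
    (surplus-nonneg-∷ false false A B)

  -- Zeroing g₀ and F₀ lets the uncrossing inequality of the whole problem speak about the tails only.
  ff+tt-nonneg : ∀ A B C D → 0₊ ≤₊ tailSurplus false false A B +₊ tailSurplus true true C D
  ff+tt-nonneg A B C D = begin
    0₊
      ≲⟨ +₊-mono-≤ (ft-nonneg _ _) (tf-nonneg _ _) ⟩
    tailSurplus false true (A ∩ C) (B ∪ D) +₊ tailSurplus true false (A ∪ C) (B ∩ D)
      ≡⟨ sym (cong₂ _+₊_ (headless false true (A ∩ C) (B ∪ D)) (headless true false (A ∪ C) (B ∩ D))) ⟩
    surplus₀ ((outside ∷ A) ∩ (inside ∷ C)) ((outside ∷ B) ∪ (inside ∷ D))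
      +₊ surplus₀ ((outside ∷ A) ∪ (inside ∷ C)) ((outside ∷ B) ∩ (inside ∷ D))
      ≲⟨ surplus-submodular H b₁-submodular b₂-submodular 0≤g₀+F₀
           (outside ∷ A) (outside ∷ B) (inside ∷ C) (inside ∷ D) ⟩
    surplus₀ (outside ∷ A) (outside ∷ B) +₊ surplus₀ (inside ∷ C) (inside ∷ D)
      ≡⟨ cong₂ _+₊_ (headless false false A B) (headless true true C D) ⟩
    tailSurplus false false A B +₊ tailSurplus true true C D ∎
    where
    open ≤₊-Reasoning
    surplus₀ = surplus b₁ b₂ (0₊ Vector.∷ tail g) (0₊ Vector.∷ tail F) H
    headless = surplus-headless b₁ b₂ (tail g) (tail F) H
    0≤g₀+F₀ : ∀ s → 0₊ ≤₊ (0₊ Vector.∷ tail g) s +₊ (0₊ Vector.∷ tail F) s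
    0≤g₀+F₀ fzero    = ≤₊-refl
    0≤g₀+F₀ (fsuc s) = 0≤g+F (fsuc s)

  -- The constraints on the value α of x₀ read 0 ≤ α + lower and 0 ≤ upper − α.
  lower upper : ℤ₊
  lower = F fzero ⊓₊ ⨅² (tailSurplus false false)
  upper = g fzero ⊓₊ ⨅² (tailSurplus true true)

  lower+upper-nonneg : 0₊ ≤₊ lower +₊ upper
  lower+upper-nonneg =
    ⊓₊-elim Below (+upper F+g-nonneg F+tt-nonneg)
                  (⨅²-elim Below _ λ A B → +upper (ff+g-nonneg A B) (ff+tt-nonneg A B))
    where
    Below : ℤ₊ → Set
    Below l = 0₊ ≤₊ l +₊ upper
    +upper : ∀ {l} → 0₊ ≤₊ l +₊ g fzero → (∀ C D → 0₊ ≤₊ l +₊ tailSurplus true true C D) → Below l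
    +upper {l} p q = ⊓₊-elim (λ u → 0₊ ≤₊ l +₊ u) p (⨅²-elim (λ u → 0₊ ≤₊ l +₊ u) _ q)

  α : ℤ
  α = proj₁ (between lower upper lower+upper-nonneg)

  α-above-lower : 0₊ ≤₊ fin₊ α +₊ lower
  α-above-lower = proj₁ (proj₂ (between lower upper lower+upper-nonneg))

  α-below-upper : 0₊ ≤₊ upper +₊ fin₊ (ℤ.- α)
  α-below-upper = proj₂ (proj₂ (between lower upper lower+upper-nonneg))

  α-above-F : 0₊ ≤₊ fin₊ α +₊ F fzero
  α-above-F = ≤₊-trans α-above-lower (+₊-monoʳ-≤ (fin₊ α) (⊓₊-≤ˡ _ _))

  α-above-ff : ∀ A B → 0₊ ≤₊ fin₊ α +₊ tailSurplus false false A B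
  α-above-ff A B = ≤₊-trans α-above-lower (+₊-monoʳ-≤ (fin₊ α) (≤₊-trans (⊓₊-≤ʳ _ _) (⨅²-≤ _ A B)))

  α-below-g : 0₊ ≤₊ g fzero +₊ fin₊ (ℤ.- α)
  α-below-g = ≤₊-trans α-below-upper (+₊-monoˡ-≤ (fin₊ (ℤ.- α)) (⊓₊-≤ˡ _ _))

  α-below-tt : ∀ C D → 0₊ ≤₊ tailSurplus true true C D +₊ fin₊ (ℤ.- α)
  α-below-tt C D = ≤₊-trans α-below-upper (+₊-monoˡ-≤ (fin₊ (ℤ.- α)) (≤₊-trans (⊓₊-≤ʳ _ _) (⨅²-≤ _ C D)))

  tt-⊥⊤ : tailSurplus true true ⊥ ⊤ ≡ b₁ (inside ∷ ⊥)
  tt-⊥⊤ = trans (surplus-⊥⊤ (b₁ ∘ (true ∷_)) (b₂ ∘ (true ∷_)) (tail g) (tail F) H)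
    (trans (cong (λ v → b₁ (inside ∷ ⊥) +₊ v +₊ fin₊ (ℤ.- H)) b₂-⊤) (+₊-cancel-fin _ H))

  tt-⊤⊥ : tailSurplus true true ⊤ ⊥ ≡ b₂ (inside ∷ ⊥)
  tt-⊤⊥ = trans (surplus-comm (b₁ ∘ (true ∷_)) (b₂ ∘ (true ∷_)) (tail g) (tail F) H ⊤ ⊥)
    (trans (surplus-⊥⊤ (b₂ ∘ (true ∷_)) (b₁ ∘ (true ∷_)) (tail g) (tail F) H)
      (trans (cong (λ v → b₂ (inside ∷ ⊥) +₊ v +₊ fin₊ (ℤ.- H)) b₁-⊤) (+₊-cancel-fin _ H)))

  ff-⊤⊥ : tailSurplus false false ⊤ ⊥ ≡ b₁ (outside ∷ ⊤) +₊ fin₊ (ℤ.- H)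
  ff-⊤⊥ = trans (surplus-comm (b₁ ∘ (false ∷_)) (b₂ ∘ (false ∷_)) (tail g) (tail F) H ⊤ ⊥)
    (trans (surplus-⊥⊤ (b₂ ∘ (false ∷_)) (b₁ ∘ (false ∷_)) (tail g) (tail F) H)
      (cong (_+₊ fin₊ (ℤ.- H)) (trans (cong (_+₊ b₁ (outside ∷ ⊤)) b₂-⊥) (+₊-identityˡ _))))

  ff-⊥⊤ : tailSurplus false false ⊥ ⊤ ≡ b₂ (outside ∷ ⊤) +₊ fin₊ (ℤ.- H)
  ff-⊥⊤ = trans (surplus-⊥⊤ (b₁ ∘ (false ∷_)) (b₂ ∘ (false ∷_)) (tail g) (tail F) H)
    (cong (_+₊ fin₊ (ℤ.- H)) (trans (cong (_+₊ b₂ (outside ∷ ⊤)) b₁-⊥) (+₊-identityˡ _)))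

  shifted-tailSurplus-nonneg : ∀ s t A B →
    0₊ ≤₊ tailSurplus s t A B +₊ (when s (fin₊ (ℤ.- α)) +₊ when t (fin₊ (ℤ.- α)) +₊ fin₊ α)
  shifted-tailSurplus-nonneg false false A B = subst (0₊ ≤₊_)
    (trans (+₊-comm _ _) (cong (λ z → tailSurplus false false A B +₊ fin₊ z) (sym (ℤP.+-identityˡ α))))
    (α-above-ff A B)
  shifted-tailSurplus-nonneg true true A B = subst (0₊ ≤₊_)
    (cong (λ z → tailSurplus true true A B +₊ fin₊ z) (sym ([-i+-i]+i≡-i α)))
    (α-below-tt A B)
  shifted-tailSurplus-nonneg true false A B = subst (0₊ ≤₊_)
    (sym (trans (cong (λ z → tailSurplus true false A B +₊ fin₊ z) ([-i+0]+i≡0 α)) (+₊-identityʳ _)))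
    (tf-nonneg A B)
  shifted-tailSurplus-nonneg false true A B = subst (0₊ ≤₊_)
    (sym (trans (cong (λ z → tailSurplus false true A B +₊ fin₊ z) ([0+-i]+i≡0 α)) (+₊-identityʳ _)))
    (ft-nonneg A B)

  reduced-surplus-nonneg : ∀ A B → 0₊ ≤₊ surplus (fixHead b₁ α) (fixHead b₂ α) (tail g) (tail F) (H ℤ.- α) A B
  reduced-surplus-nonneg A B =
    subst (0₊ ≤₊_)
      (sym (surplus-shift {b₁ = b₁ ∘ (s ∷_)} {b₂ ∘ (t ∷_)} {fixHead b₁ α} {fixHead b₂ α} (tail g) (tail F) H α e₁ e₂))
      (shifted-tailSurplus-nonneg s t A B)
    where
    s = proj₁ (fixHead-attained b₁ α A)
    e₁ = proj₂ (fixHead-attained b₁ α A)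
    t = proj₁ (fixHead-attained b₂ α B)
    e₂ = proj₂ (fixHead-attained b₂ α B)

  reduced : Problem n
  reduced = record
    { b₁             = fixHead b₁ α
    ; b₂             = fixHead b₂ α
    ; g              = tail g
    ; F              = tail F
    ; H              = H ℤ.- α
    ; b₁-submodular  = fixHead-submodular b₁-submodular α
    ; b₂-submodular  = fixHead-submodular b₂-submodular α
    ; b₁-⊥           = fixHead-⊥ b₁ b₁-⊥ (subst (λ v → 0₊ ≤₊ v +₊ fin₊ (ℤ.- α)) tt-⊥⊤ (α-below-tt ⊥ ⊤))
    ; b₂-⊥           = fixHead-⊥ b₂ b₂-⊥ (subst (λ v → 0₊ ≤₊ v +₊ fin₊ (ℤ.- α)) tt-⊤⊥ (α-below-tt ⊤ ⊥))
    ; b₁-⊤           = fixHead-⊤ b₁ b₁-⊤ (subst (λ v → 0₊ ≤₊ fin₊ α +₊ v) ff-⊤⊥ (α-above-ff ⊤ ⊥))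
    ; b₂-⊤           = fixHead-⊤ b₂ b₂-⊤ (subst (λ v → 0₊ ≤₊ fin₊ α +₊ v) ff-⊥⊤ (α-above-ff ⊥ ⊤))
    ; 0≤g+F          = 0≤g+F ∘ fsuc
    ; surplus-nonneg = reduced-surplus-nonneg
    }

  extend : Solution reduced → Solution P
  extend sol = record
    { x     = α Vector.∷ y
    ; sum≡H = trans (cong (λ t → α ℤ.+ t) sum≡H) (i+[j-i]≡j α H)
    ; x≤b₁  = ∷-≤-fixHead x≤b₁
    ; x≤b₂  = ∷-≤-fixHead x≤b₂
    ; x≤g   = λ { fzero → slack⇒≤₊ α-below-g ; (fsuc s) → x≤g s }
    ; -F≤x  = λ { fzero → α-above-F ; (fsuc s) → -F≤x s }
    }
    where open Solution sol renaming (x to y)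

solution : ∀ {n} (P : Problem n) → Solution P
solution {zero}  P = solution₀ P
solution {suc n} P = Step.extend P (solution (Step.reduced P))

-- Strong pairs with p(S) = b(S) = H

module _ {n} {p : LowerSetFn n} {b : UpperSetFn n} {H : ℤ}
         (strong : StrongPair p b) (p⊤ : p ⊤ ≡ fin₋ H) (b⊤ : b ⊤ ≡ fin₊ H) where

  strongPair-complement : ∀ Z → b (∁ Z) +₊ fin₊ (ℤ.- H) ≡ neg (p Z)
  strongPair-complement Z = ≤₊-antisym upper lower
    where
    p⊥ = proj₁ strong
    b⊥ = proj₁ (proj₂ strong)
    exchange = proj₂ (proj₂ (proj₂ (proj₂ strong)))
    m = fin₊ (ℤ.- H)
    open ≤₊-Reasoning
    upper : b (∁ Z) +₊ m ≤₊ neg (p Z)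
    upper = begin
      b (∁ Z) +₊ m                       ≡⟨ cong (_+₊ m) (sym (+₊-identityʳ _)) ⟩
      b (∁ Z) +₊ 0₊ +₊ m
        ≡⟨ sym (cong₂ (λ X v → b X +₊ v +₊ m) (⊤─≡∁ Z) (trans (cong (neg ∘ p) (p─⊤≡⊥ Z)) (cong neg p⊥))) ⟩
      b (⊤ ─ Z) +₊ neg (p (Z ─ ⊤)) +₊ m  ≲⟨ +₊-monoˡ-≤ m (exchange ⊤ Z) ⟩
      b ⊤ +₊ neg (p Z) +₊ m              ≡⟨ cong (λ v → v +₊ neg (p Z) +₊ m) b⊤ ⟩
      fin₊ H +₊ neg (p Z) +₊ m           ≡⟨ cong (_+₊ m) (+₊-comm _ _) ⟩
      neg (p Z) +₊ fin₊ H +₊ m           ≡⟨ +₊-cancel-fin _ H ⟩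
      neg (p Z)                          ∎
    lower : neg (p Z) ≤₊ b (∁ Z) +₊ m
    lower = begin
      neg (p Z)                          ≡⟨ sym (+₊-identityˡ _) ⟩
      0₊ +₊ neg (p Z)
        ≡⟨ sym (cong₂ _+₊_ (trans (cong b (p─⊤≡⊥ (∁ Z))) b⊥)
                           (cong (neg ∘ p) (trans (⊤─≡∁ (∁ Z)) (∁-involutive Z)))) ⟩
      b (∁ Z ─ ⊤) +₊ neg (p (⊤ ─ ∁ Z))   ≲⟨ exchange (∁ Z) ⊤ ⟩
      b (∁ Z) +₊ neg (p ⊤)               ≡⟨ cong (λ v → b (∁ Z) +₊ neg v) p⊤ ⟩
      b (∁ Z) +₊ m                       ∎

  base⊆Q : ∀ x → tildeℤ x ⊤ ≡ H → (∀ Z → fin₊ (tildeℤ x Z) ≤₊ b Z) → Q p b x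
  base⊆Q x sum≡H x≤b Z = slack⇒≤⁎ p≤x , ≤₊⇒fin-≤⁎ (x≤b Z)
    where
    sum-vanishes : tildeℤ x Z ℤ.+ (tildeℤ x (∁ Z) ℤ.+ ℤ.- H) ≡ + 0
    sum-vanishes = trans (sym (ℤP.+-assoc (tildeℤ x Z) (tildeℤ x (∁ Z)) (ℤ.- H)))
      (trans (cong (ℤ._+ ℤ.- H) (trans (tildeℤ-+-∁ x Z) sum≡H)) (ℤP.+-inverseʳ H))
    p≤x : 0₊ ≤₊ fin₊ (tildeℤ x Z) +₊ neg (p Z)
    p≤x = begin
      0₊
        ≡⟨ cong fin₊ (sym sum-vanishes) ⟩
      fin₊ (tildeℤ x Z) +₊ (fin₊ (tildeℤ x (∁ Z)) +₊ fin₊ (ℤ.- H))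
        ≲⟨ +₊-monoʳ-≤ _ (+₊-monoˡ-≤ _ (x≤b (∁ Z))) ⟩
      fin₊ (tildeℤ x Z) +₊ (b (∁ Z) +₊ fin₊ (ℤ.- H))
        ≡⟨ cong (fin₊ (tildeℤ x Z) +₊_) (strongPair-complement Z) ⟩
      fin₊ (tildeℤ x Z) +₊ neg (p Z) ∎
      where open ≤₊-Reasoning

  condition⇔surplus : ∀ (b′ : UpperSetFn n) (f : Fin n → ℤ₋) (g : Fin n → ℤ₊) →
    (∀ X₁ X₂ → p X₁ +₋ tilde₋ f (X₂ ─ X₁) ≤⁎ b′ X₂ +₊ tilde₊ g (X₁ ─ X₂))
    ⇔ (∀ X Y → 0₊ ≤₊ surplus b b′ g (neg ∘ f) H X Y)
  condition⇔surplus b′ f g = mk⇔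
    (λ h X Y → subst (λ X → 0₊ ≤₊ surplus b b′ g (neg ∘ f) H X Y) (∁-involutive X)
                 (subst (0₊ ≤₊_) (slack≡surplus (∁ X) Y) (≤⁎⇒slack (h (∁ X) Y))))
    (λ h X₁ X₂ → slack⇒≤⁎ (subst (0₊ ≤₊_) (sym (slack≡surplus X₁ X₂)) (h (∁ X₁) X₂)))
    where
    slack≡surplus : ∀ X₁ X₂ →
      b′ X₂ +₊ tilde₊ g (X₁ ─ X₂) +₊ neg (p X₁ +₋ tilde₋ f (X₂ ─ X₁)) ≡ surplus b b′ g (neg ∘ f) H (∁ X₁) X₂
    slack≡surplus X₁ X₂ = begin
      b′ X₂ +₊ tilde₊ g (X₁ ─ X₂) +₊ neg (p X₁ +₋ tilde₋ f (X₂ ─ X₁))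
        ≡⟨ cong (b′ X₂ +₊ tilde₊ g (X₁ ─ X₂) +₊_)
             (trans (neg-+ (p X₁) _) (cong₂ _+₊_ (sym (strongPair-complement X₁)) (neg-tilde₋ f (X₂ ─ X₁)))) ⟩
      b′ X₂ +₊ tilde₊ g (X₁ ─ X₂) +₊ (b (∁ X₁) +₊ m +₊ tilde₊ (neg ∘ f) (X₂ ─ X₁))
        ≡⟨ solve 5 (λ c G a m F′ → (c ⊕ G) ⊕ ((a ⊕ m) ⊕ F′) ⊜ (((a ⊕ c) ⊕ G) ⊕ F′) ⊕ m)
             refl (b′ X₂) (tilde₊ g (X₁ ─ X₂)) (b (∁ X₁)) m (tilde₊ (neg ∘ f) (X₂ ─ X₁)) ⟩
      b (∁ X₁) +₊ b′ X₂ +₊ tilde₊ g (X₁ ─ X₂) +₊ tilde₊ (neg ∘ f) (X₂ ─ X₁) +₊ m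
        ≡⟨ cong₂ (λ U V → b (∁ X₁) +₊ b′ X₂ +₊ tilde₊ g U +₊ tilde₊ (neg ∘ f) V +₊ m)
             (trans (─≡∩∁ X₁ X₂) (cong (_∩ ∁ X₂) (sym (∁-involutive X₁))))
             (trans (─≡∩∁ X₂ X₁) (∩-comm X₂ (∁ X₁))) ⟩
      surplus b b′ g (neg ∘ f) H (∁ X₁) X₂ ∎
      where
      open ≡-Reasoning
      m = fin₊ (ℤ.- H)

Q-sum≡H : ∀ {n} {p : LowerSetFn n} {b : UpperSetFn n} {H x} →
  p ⊤ ≡ fin₋ H → b ⊤ ≡ fin₊ H → Q p b x → tildeℤ x ⊤ ≡ H
Q-sum≡H {x = x} p⊤ b⊤ q =
  ℤP.≤-antisym (subst (fin₋ (tildeℤ x ⊤) ≤⁎_) b⊤ (proj₂ (q ⊤))) (subst (_≤⁎ fin₊ (tildeℤ x ⊤)) p⊤ (proj₁ (q ⊤)))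

bound⇔surplus : ∀ {n} (b₁ b₂ : UpperSetFn n) (f : Fin n → ℤ₋) g H X Y →
  (fin₋ H ≤⁎ b₁ X +₊ b₂ Y +₊ tilde₊ g (∁ X ∩ ∁ Y) +₊ neg (tilde₋ f (X ∩ Y)))
  ⇔ (0₊ ≤₊ surplus b₁ b₂ g (neg ∘ f) H X Y)
bound⇔surplus b₁ b₂ f g H X Y = mk⇔ (subst (0₊ ≤₊_) e ∘ ≤⁎⇒slack) (slack⇒≤⁎ ∘ subst (0₊ ≤₊_) (sym e))
  where
  e = cong (λ v → b₁ X +₊ b₂ Y +₊ tilde₊ g (∁ X ∩ ∁ Y) +₊ v +₊ fin₊ (ℤ.- H)) (neg-tilde₋ f (X ∩ Y))

feasible⇒surplus-nonneg : ∀ {n} {p₁ p₂ : LowerSetFn n} {b₁ b₂ : UpperSetFn n} {H} {f : Fin n → ℤ₋} {g : Fin n → ℤ₊} →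
  p₁ ⊤ ≡ fin₋ H → b₁ ⊤ ≡ fin₊ H → ∀ x → Q p₁ b₁ x → Q p₂ b₂ x → T f g x →
  ∀ X Y → 0₊ ≤₊ surplus b₁ b₂ g (neg ∘ f) H X Y
feasible⇒surplus-nonneg {b₁ = b₁} {b₂} {H} {f} {g} p₁⊤ b₁⊤ x q₁ q₂ t X Y =
  subst (0₊ ≤₊_) (cong (_+₊ fin₊ (ℤ.- H)) (sym (+₊-assoc _ (tilde₊ g (∁ X ∩ ∁ Y)) _))) (≤⁎⇒slack (≤₊⇒fin-≤⁎ H≤))
  where
  x̂≤ : ∀ {p b} → Q p b x → ∀ Z → tilde₊ (fin₊ ∘ x) Z ≤₊ b Z
  x̂≤ q Z = subst (_≤₊ _) (fin₊-tildeℤ x Z) (fin-≤⁎⇒≤₊ (proj₂ (q Z)))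
  H≤ : fin₊ H ≤₊ (b₁ X +₊ b₂ Y) +₊ (tilde₊ g (∁ X ∩ ∁ Y) +₊ tilde₊ (neg ∘ f) (X ∩ Y))
  H≤ = begin
    fin₊ H                    ≡⟨ cong fin₊ (sym (Q-sum≡H p₁⊤ b₁⊤ q₁)) ⟩
    fin₊ (tildeℤ x ⊤)         ≡⟨ fin₊-tildeℤ x ⊤ ⟩
    tilde₊ (fin₊ ∘ x) ⊤
      ≲⟨ tilde₊-box (fin₊ ∘ x) g (neg ∘ f) (λ s → fin-≤⁎⇒≤₊ (proj₂ (t s))) (λ s → ≤⁎⇒slack (proj₁ (t s))) X Y ⟩
    (tilde₊ (fin₊ ∘ x) X +₊ tilde₊ (fin₊ ∘ x) Y) +₊ (tilde₊ g (∁ X ∩ ∁ Y) +₊ tilde₊ (neg ∘ f) (X ∩ Y))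
      ≲⟨ +₊-monoˡ-≤ _ (+₊-mono-≤ (x̂≤ q₁ X) (x̂≤ q₂ Y)) ⟩
    (b₁ X +₊ b₂ Y) +₊ (tilde₊ g (∁ X ∩ ∁ Y) +₊ tilde₊ (neg ∘ f) (X ∩ Y)) ∎
    where open ≤₊-Reasoning

surplus-nonneg⇒feasible : ∀ {n} {p₁ p₂ : LowerSetFn n} {b₁ b₂ : UpperSetFn n} {H} →
  StrongPair p₁ b₁ → StrongPair p₂ b₂ → p₁ ⊤ ≡ fin₋ H → b₁ ⊤ ≡ fin₊ H → p₂ ⊤ ≡ fin₋ H → b₂ ⊤ ≡ fin₊ H →
  ∀ {f : Fin n → ℤ₋} {g : Fin n → ℤ₊} → (∀ s → f s ≤⁎ g s) → (∀ X Y → 0₊ ≤₊ surplus b₁ b₂ g (neg ∘ f) H X Y) →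
  Σ (Fin n → ℤ) λ x → Q p₁ b₁ x × Q p₂ b₂ x × T f g x
surplus-nonneg⇒feasible {b₁ = b₁} {b₂} {H} sp₁ sp₂ p₁⊤ b₁⊤ p₂⊤ b₂⊤ {f} {g} f≤g nonneg =
  x , base⊆Q sp₁ p₁⊤ b₁⊤ x sum≡H x≤b₁ , base⊆Q sp₂ p₂⊤ b₂⊤ x sum≡H x≤b₂
    , λ s → slack⇒≤⁎ (-F≤x s) , ≤₊⇒fin-≤⁎ (x≤g s)
  where
  problem : Problem _
  problem = record
    { b₁             = b₁
    ; b₂             = b₂
    ; g              = g
    ; F              = neg ∘ f
    ; H              = H
    ; b₁-submodular  = proj₁ (proj₂ (proj₂ (proj₂ sp₁)))
    ; b₂-submodular  = proj₁ (proj₂ (proj₂ (proj₂ sp₂)))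
    ; b₁-⊥           = proj₁ (proj₂ sp₁)
    ; b₂-⊥           = proj₁ (proj₂ sp₂)
    ; b₁-⊤           = b₁⊤
    ; b₂-⊤           = b₂⊤
    ; 0≤g+F          = λ s → ≤⁎⇒slack (f≤g s)
    ; surplus-nonneg = nonneg
    }
  open Solution (solution problem)

∀-flip-⇔ : ∀ {A : Set} {R : A → A → Set} → (∀ X Y → R X Y) ⇔ (∀ X Y → R Y X)
∀-flip-⇔ = mk⇔ (λ h X Y → h Y X) (λ h X Y → h Y X)

surplus-nonneg-comm : ∀ {n} (b₁ b₂ : Subset n → ℤ₊) g F H →
  (∀ X Y → 0₊ ≤₊ surplus b₂ b₁ g F H X Y) ⇔ (∀ X Y → 0₊ ≤₊ surplus b₁ b₂ g F H X Y)
surplus-nonneg-comm b₁ b₂ g F H =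
  mk⇔ (λ h X Y → subst (0₊ ≤₊_) (surplus-comm b₂ b₁ g F H Y X) (h Y X))
      (λ h X Y → subst (0₊ ≤₊_) (surplus-comm b₁ b₂ g F H Y X) (h Y X))

corollary4p4 : (n : ℕ) (p₁ : LowerSetFn n) (b₁ : UpperSetFn n)
    (p₂ : LowerSetFn n) (b₂ : UpperSetFn n) (H : ℤ) →
    StrongPair p₁ b₁ → StrongPair p₂ b₂ →
    p₁ ⊤ ≡ fin₋ H → b₁ ⊤ ≡ fin₊ H → p₂ ⊤ ≡ fin₋ H → b₂ ⊤ ≡ fin₊ H →
    (f : Fin n → ℤ₋) (g : Fin n → ℤ₊) → (∀ s → f s ≤⁎ g s) →
    ((∀ X₁ X₂ → p₁ X₁ +₋ tilde₋ f (X₂ ─ X₁) ≤⁎ b₂ X₂ +₊ tilde₊ g (X₁ ─ X₂))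
      ⇔ (∀ X₁ X₂ → p₂ X₂ +₋ tilde₋ f (X₁ ─ X₂) ≤⁎ b₁ X₁ +₊ tilde₊ g (X₂ ─ X₁)))
    × ((Σ (Fin n → ℤ) λ x → Q p₁ b₁ x × Q p₂ b₂ x × T f g x)
      ⇔ (∀ (X′ X″ : Subset n) →
           fin₋ H ≤⁎ b₁ X′ +₊ b₂ X″ +₊ tilde₊ g (∁ X′ ∩ ∁ X″)
                     +₊ neg (tilde₋ f (X′ ∩ X″))))
corollary4p4 n p₁ b₁ p₂ b₂ H sp₁ sp₂ p₁⊤ b₁⊤ p₂⊤ b₂⊤ f g f≤g =
  ⇔-trans (condition⇔surplus sp₁ p₁⊤ b₁⊤ b₂ f g)
          (⇔-sym (⇔-trans ∀-flip-⇔ (⇔-trans (condition⇔surplus sp₂ p₂⊤ b₂⊤ b₁ f g)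
                                              (surplus-nonneg-comm b₁ b₂ g (neg ∘ f) H))))
  , mk⇔ (λ (x , q₁ , q₂ , t) X′ X″ → from (bound X′ X″) (feasible⇒surplus-nonneg p₁⊤ b₁⊤ x q₁ q₂ t X′ X″))
        (λ h → surplus-nonneg⇒feasible sp₁ sp₂ p₁⊤ b₁⊤ p₂⊤ b₂⊤ f≤g (λ X Y → to (bound X Y) (h X Y)))
  where
  open Equivalence using (to; from)
  bound = bound⇔surplus b₁ b₂ f g H
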